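{- For every $v\in V(G)$ with $|N(v)|>\ell$, we have $|\mathcal{T}(v)|\le 2(2k^2)^k$ and $|\mathcal{P}(v)|\le 2k(2k^2)^k\le(2k)^{2k+1}$.
   Context: Graphs are finite, simple, undirected. $N(v)$ is the open and $N[v]=N(v)\cup\{v\}$ the closed neighborhood. $\nabla_1(G)$ is the maximum of $|E(H)|/|V(H)|$ over all $1$-shallow minors $H$ of $G$ (graphs obtained from pairwise vertex-disjoint connected subgraphs of $G$ of radius at most $1$ as branch sets, two vertices adjacent when some edge of $G$ joins their branch sets). Standing assumptions: $G$ is a fixed graph such that for every $v\in V(G)$, $N(v)$ can be dominated by at most $2\nabla_1(G)$ vertices different from $v$. Set $\nabla_1=\nabla_1(G)$, $k=2\nabla_1$, $\alpha=1/k$, $\ell=4k^3+1$, $q=4k^4$. A vertex $z$ is $\alpha$-strong for $W$ if $|N[z]\cap W|\ge\alpha|W|$. A pseudo-cover of $W$ is a sequence $(v_1,\ldots,v_m)$ with $m\le k$, $|W\setminus\bigcup_{i\le m}N[v_i]|\le q$, and for every $i\le m$: $v_i$ is $\alpha$-strong for $W\setminus\bigcup_{j<i}N[v_j]$ and $|N[v_i]\cap(W\setminus\bigcup_{j<i}N[v_j])|\ge\ell$. $\mathcal{T}(v)$ is the set of all pseudo-covers of $N(v)$ and $\mathcal{P}(v)$ is the set of all vertices appearing in some pseudo-cover of $N(v)$. -}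

module Defs where

open import Data.Bool using (Bool; true; false; _∧_; if_then_else_)
open import Data.Nat as ℕ using (ℕ; zero; suc; _<ᵇ_)
open import Data.Integer using (+_)
open import Data.Rational using (ℚ; _/_; _≤_; _+_; _*_; 1ℚ)
open import Data.Fin using (Fin; toℕ)
open import Data.Fin.Subset using (Subset; _∈_; _∉_; _⊆_; _∩_; _∪_; _─_; ∣_∣; ⁅_⁆)
open import Data.Vec using (tabulate; lookup)
open import Data.List using (List; []; _∷_; length; map; allFin)
open import Data.Bool.ListAction using (any)
open import Data.Nat.ListAction using (sum)
open import Data.List.Membership.Propositional using () renaming (_∈_ to _∈ₗ_)
open import Data.Product using (Σ; ∃; _×_)
open import Relation.Binary.PropositionalEquality using (_≡_; _≢_)

record Graph : Set where
  field
    n      : ℕ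
    adj    : Fin n → Fin n → Bool
    sym    : ∀ u v → adj u v ≡ adj v u
    irrefl : ∀ v → adj v v ≡ false

ℕ→ℚ : ℕ → ℚ
ℕ→ℚ c = (+ c) / 1

infixr 8 _^ℚ_
_^ℚ_ : ℚ → ℕ → ℚ
x ^ℚ zero  = 1ℚ
x ^ℚ suc e = x * (x ^ℚ e)

module _ (G : Graph) where
  open Graph G

  N : Fin n → Subset n
  N v = tabulate (adj v)

  Nc : Fin n → Subset n
  Nc v = ⁅ v ⁆ ∪ N v

  -- A 1-shallow minor model with m branch sets: pairwise disjoint vertex sets,
  -- each inducing a connected subgraph of radius ≤ 1, i.e. containing a centre
  -- vertex c with branch ⊆ N[c].
  record Shallow1Model (m : ℕ) : Set where
    field
      center   : Fin m → Fin n
      branch   : Fin m → Subset n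
      center∈  : ∀ i → center i ∈ branch i
      star     : ∀ i → branch i ⊆ Nc (center i)
      disjoint : ∀ i j → i ≢ j → ∀ u → u ∈ branch i → u ∉ branch j

  hasEdge : ∀ {m} → Shallow1Model m → Fin m → Fin m → Bool
  hasEdge M i j =
    any (λ u → any (λ w → lookup (branch i) u ∧ lookup (branch j) w ∧ adj u w)
                   (allFin n))
        (allFin n)
    where open Shallow1Model M

  edgeCount : ∀ {m} → Shallow1Model m → ℕ
  edgeCount {m} M =
    sum (map (λ i → sum (map (λ j → if (toℕ i <ᵇ toℕ j) ∧ hasEdge M i j then 1 else 0)
                             (allFin m)))
             (allFin m))

  density : ∀ {m} → Shallow1Model (suc m) → ℚ
  density {m} M = (+ edgeCount M) / suc m

  IsNabla1 : ℚ → Set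
  IsNabla1 d = (Σ ℕ λ m → Σ (Shallow1Model (suc m)) λ M → density M ≡ d)
             × (∀ m (M : Shallow1Model (suc m)) → density M ≤ d)

  module _ (d : ℚ) where
    kk : ℚ
    kk = ℕ→ℚ 2 * d

    ℓℓ : ℚ
    ℓℓ = ℕ→ℚ 4 * kk ^ℚ 3 + 1ℚ

    qq : ℚ
    qq = ℕ→ℚ 4 * kk ^ℚ 4

    DomAssumption : Set
    DomAssumption = ∀ v → Σ (Subset n) λ D → v ∉ D × ℕ→ℚ ∣ D ∣ ≤ kk
                      × (∀ u → u ∈ N v → Σ (Fin n) λ w → w ∈ D × u ∈ Nc w)

    -- z is α-strong for W (α = 1/k):  α|W| ≤ |N[z] ∩ W|, written as |W| ≤ k·|N[z] ∩ W|
    Strong : Subset n → Fin n → Set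
    Strong W z = ℕ→ℚ ∣ W ∣ ≤ kk * ℕ→ℚ ∣ Nc z ∩ W ∣

    -- the conditions on a pseudo-cover other than its length, W being the
    -- set of still-uncovered vertices
    PC : Subset n → List (Fin n) → Set
    PC W []       = ℕ→ℚ ∣ W ∣ ≤ qq
    PC W (v ∷ vs) = Strong W v × ℓℓ ≤ ℕ→ℚ ∣ Nc v ∩ W ∣ × PC (W ─ Nc v) vs

    IsPseudoCover : Subset n → List (Fin n) → Set
    IsPseudoCover W vs = ℕ→ℚ (length vs) ≤ kk × PC W vs

    InP : Fin n → Fin n → Set
    InP v u = Σ (List (Fin n)) λ vs → IsPseudoCover (N v) vs × u ∈ₗ vs

-- Write k = a/B. Every vertex of a pseudo-cover of W = N(v) is a candidate for the set W′ of
-- still-uncovered vertices: it is α-strong for W′ and sees at least ℓ vertices of W′. For a fixed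
-- W′ there are at most 2k² candidates z₁ … z_t. Indeed, singleton branch sets on the zᵢ and W′
-- form a 1-shallow minor, so the degree sum of the subgraph they span is at most k(t + |W′|);
-- each zᵢ has at least s - 1 neighbours there, where s = |N[zᵢ] ∩ W′| satisfies ks ≥ |W′| and
-- s ≥ ℓ ≥ 2k + 2, so 2k(s - 1) ≥ |W′| + 2k²; summing, t(|W′| + 2k²) ≤ 2k²(t + |W′|), i.e.
-- t ≤ 2k². (That ℓ ≥ 2k + 2 uses k ≥ 1, which holds because N(v) ≠ ∅ gives G an edge.)
-- Hence pseudo-covers are paths from the root of a tree of depth ⌊k⌋ and branching ⌊2k²⌋,
-- which has fewer than 2(2k²)^k nodes, and each contributes at most k vertices to 𝒫(v).
-- The powers with exponent k are handled by raising both sides to the B-th power.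

module Submission where

module Fraction where

  open import Data.Nat as ℕ using (ℕ; zero; suc; NonZero)
  import Data.Nat.Properties as ℕ
  open import Data.Integer as ℤ using (+_)
  import Data.Integer.Properties as ℤ
  open import Data.Rational as ℚ using (ℚ; _/_; toℚᵘ)
  import Data.Rational.Properties as ℚ
  import Data.Rational.Unnormalised as ℚᵘ
  import Data.Rational.Unnormalised.Properties as ℚᵘ
  open import Relation.Binary.PropositionalEquality
  open import Defs using (_^ℚ_; ℕ→ℚ)

  infix 8 _/ℕ_
  _/ℕ_ : (p D : ℕ) .{{_ : NonZero D}} → ℚ
  p /ℕ D = + p / D

  private
    unnormalised : (p D : ℕ) .{{_ : NonZero D}} → ℚᵘ.ℚᵘ
    unnormalised p D = ℚᵘ.mkℚᵘ (+ p) (ℕ.pred D)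

    toℚᵘ-/ℕ : ∀ p D .{{_ : NonZero D}} → toℚᵘ (p /ℕ D) ℚᵘ.≃ unnormalised p D
    toℚᵘ-/ℕ p D = ℚᵘ.≃-trans
      (ℚᵘ.≃-reflexive (cong toℚᵘ (ℚ./-cong {+ p} refl (sym (ℕ.suc-pred D)))))
      (ℚ.toℚᵘ-fromℚᵘ (unnormalised p D))

    unnormalised-≤⇒ : ∀ p D q E .{{_ : NonZero D}} .{{_ : NonZero E}} →
      unnormalised p D ℚᵘ.≤ unnormalised q E → p ℕ.* E ℕ.≤ q ℕ.* D
    unnormalised-≤⇒ p (suc D) q (suc E) (ℚᵘ.*≤* r)
      rewrite sym (ℤ.pos-* p (suc E)) | sym (ℤ.pos-* q (suc D)) = ℤ.drop‿+≤+ r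

    ≤⇒unnormalised-≤ : ∀ p D q E .{{_ : NonZero D}} .{{_ : NonZero E}} →
      p ℕ.* E ℕ.≤ q ℕ.* D → unnormalised p D ℚᵘ.≤ unnormalised q E
    ≤⇒unnormalised-≤ p (suc D) q (suc E) le =
      ℚᵘ.*≤* (subst₂ ℤ._≤_ (ℤ.pos-* p (suc E)) (ℤ.pos-* q (suc D)) (ℤ.+≤+ le))

  /ℕ-≤⇒ : ∀ p D q E .{{_ : NonZero D}} .{{_ : NonZero E}} →
    p /ℕ D ℚ.≤ q /ℕ E → p ℕ.* E ℕ.≤ q ℕ.* D
  /ℕ-≤⇒ p D q E le = unnormalised-≤⇒ p D q E
    (ℚᵘ.≤-respʳ-≃ (toℚᵘ-/ℕ q E) (ℚᵘ.≤-respˡ-≃ (toℚᵘ-/ℕ p D) (ℚ.toℚᵘ-mono-≤ le)))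

  ≤⇒/ℕ-≤ : ∀ p D q E .{{_ : NonZero D}} .{{_ : NonZero E}} →
    p ℕ.* E ℕ.≤ q ℕ.* D → p /ℕ D ℚ.≤ q /ℕ E
  ≤⇒/ℕ-≤ p D q E le = ℚ.toℚᵘ-cancel-≤ (ℚᵘ.≤-respʳ-≃ (ℚᵘ.≃-sym (toℚᵘ-/ℕ q E))
    (ℚᵘ.≤-respˡ-≃ (ℚᵘ.≃-sym (toℚᵘ-/ℕ p D)) (≤⇒unnormalised-≤ p D q E le)))

  ≡⇒/ℕ-≡ : ∀ p D q E .{{_ : NonZero D}} .{{_ : NonZero E}} →
    p ℕ.* E ≡ q ℕ.* D → p /ℕ D ≡ q /ℕ E
  ≡⇒/ℕ-≡ p D q E eq =
    ℚ.≤-antisym (≤⇒/ℕ-≤ p D q E (ℕ.≤-reflexive eq)) (≤⇒/ℕ-≤ q E p D (ℕ.≤-reflexive (sym eq)))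

  /ℕ-* : ∀ p D q E .{{_ : NonZero D}} .{{_ : NonZero E}} →
    p /ℕ D ℚ.* q /ℕ E ≡ _/ℕ_ (p ℕ.* q) (D ℕ.* E) {{ℕ.m*n≢0 D E}}
  /ℕ-* p D@(suc _) q E@(suc _) = ℚ.toℚᵘ-injective (begin
    toℚᵘ (p /ℕ D ℚ.* q /ℕ E)               ≈⟨ ℚ.toℚᵘ-homo-* (p /ℕ D) (q /ℕ E) ⟩
    toℚᵘ (p /ℕ D) ℚᵘ.* toℚᵘ (q /ℕ E)       ≈⟨ ℚᵘ.*-cong (toℚᵘ-/ℕ p D) (toℚᵘ-/ℕ q E) ⟩
    unnormalised p D ℚᵘ.* unnormalised q E ≈⟨ ℚᵘ.*≡* (cong (ℤ._* + (D ℕ.* E)) (sym (ℤ.pos-* p q))) ⟩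
    unnormalised (p ℕ.* q) (D ℕ.* E)       ≈⟨ ℚᵘ.≃-sym (toℚᵘ-/ℕ (p ℕ.* q) (D ℕ.* E)) ⟩
    toℚᵘ ((p ℕ.* q) /ℕ (D ℕ.* E))          ∎)
    where open ℚᵘ.≃-Reasoning

  /ℕ-+ : ∀ p D q E .{{_ : NonZero D}} .{{_ : NonZero E}} →
    p /ℕ D ℚ.+ q /ℕ E ≡ _/ℕ_ (p ℕ.* E ℕ.+ q ℕ.* D) (D ℕ.* E) {{ℕ.m*n≢0 D E}}
  /ℕ-+ p D@(suc _) q E@(suc _) = ℚ.toℚᵘ-injective (begin
    toℚᵘ (p /ℕ D ℚ.+ q /ℕ E)                     ≈⟨ ℚ.toℚᵘ-homo-+ (p /ℕ D) (q /ℕ E) ⟩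
    toℚᵘ (p /ℕ D) ℚᵘ.+ toℚᵘ (q /ℕ E)             ≈⟨ ℚᵘ.+-cong (toℚᵘ-/ℕ p D) (toℚᵘ-/ℕ q E) ⟩
    unnormalised p D ℚᵘ.+ unnormalised q E       ≈⟨ ℚᵘ.*≡* (cong (ℤ._* + (D ℕ.* E)) numerator) ⟩
    unnormalised (p ℕ.* E ℕ.+ q ℕ.* D) (D ℕ.* E) ≈⟨ ℚᵘ.≃-sym (toℚᵘ-/ℕ (p ℕ.* E ℕ.+ q ℕ.* D) (D ℕ.* E)) ⟩
    toℚᵘ ((p ℕ.* E ℕ.+ q ℕ.* D) /ℕ (D ℕ.* E))    ∎)
    where
    open ℚᵘ.≃-Reasoning
    numerator : + p ℤ.* + E ℤ.+ + q ℤ.* + D ≡ + (p ℕ.* E ℕ.+ q ℕ.* D)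
    numerator = trans (cong₂ ℤ._+_ (sym (ℤ.pos-* p E)) (sym (ℤ.pos-* q D)))
                      (sym (ℤ.pos-+ (p ℕ.* E) (q ℕ.* D)))

  /ℕ-^ : ∀ p D n .{{_ : NonZero D}} → (p /ℕ D) ^ℚ n ≡ _/ℕ_ (p ℕ.^ n) (D ℕ.^ n) {{ℕ.m^n≢0 D n}}
  /ℕ-^ p D zero = refl
  /ℕ-^ p D (suc n) {{D≢0}} = trans (cong (p /ℕ D ℚ.*_) (/ℕ-^ p D n))
                                   (/ℕ-* p D (p ℕ.^ n) (D ℕ.^ n) {{D≢0}} {{ℕ.m^n≢0 D n}})

  ℕ→ℚ-*-/ℕ : ∀ p q E .{{_ : NonZero E}} → ℕ→ℚ p ℚ.* q /ℕ E ≡ (p ℕ.* q) /ℕ E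
  ℕ→ℚ-*-/ℕ p q E {{E≢0}} = trans (/ℕ-* p 1 q E)
    (≡⇒/ℕ-≡ (p ℕ.* q) (1 ℕ.* E) (p ℕ.* q) E {{ℕ.m*n≢0 1 E}} {{E≢0}} (cong (p ℕ.* q ℕ.*_) (sym (ℕ.*-identityˡ E))))

  /ℕ-*-ℕ→ℚ : ∀ p D q .{{_ : NonZero D}} → p /ℕ D ℚ.* ℕ→ℚ q ≡ (p ℕ.* q) /ℕ D
  /ℕ-*-ℕ→ℚ p D q {{D≢0}} = trans (/ℕ-* p D q 1)
    (≡⇒/ℕ-≡ (p ℕ.* q) (D ℕ.* 1) (p ℕ.* q) D {{ℕ.m*n≢0 D 1}} {{D≢0}} (cong (p ℕ.* q ℕ.*_) (sym (ℕ.*-identityʳ D))))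

  ℕ→ℚ-^ : ∀ x k → ℕ→ℚ x ^ℚ k ≡ ℕ→ℚ (x ℕ.^ k)
  ℕ→ℚ-^ x k = trans (/ℕ-^ x 1 k)
    (≡⇒/ℕ-≡ (x ℕ.^ k) (1 ℕ.^ k) (x ℕ.^ k) 1 {{ℕ.m^n≢0 1 k}} (cong (x ℕ.^ k ℕ.*_) (sym (ℕ.^-zeroˡ k))))


module Counting where

  open import Data.Bool using (Bool; true; false; _∧_; if_then_else_; T)
  open import Data.Bool.Properties using (T-≡)
  open import Function.Bundles using (Equivalence)
  open import Data.Nat as ℕ using (ℕ; zero; suc; _+_; _*_; _≤_; _<ᵇ_; z≤n; s≤s)
  import Data.Nat.Properties as ℕ
  open import Data.Fin as Fin using (Fin; zero; suc; toℕ)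
  import Data.Fin.Properties as Fin
  open import Data.Fin.Subset using (Subset; _∈_; ∣_∣; inside; outside)
  open import Data.Vec using ([]; _∷_; here; there)
  open import Data.List as List using (List; []; _∷_; map; length; _++_; concat; allFin; tabulate; lookup; filterᵇ)
  import Data.List.Properties as List
  open import Data.List.Membership.Propositional using () renaming (_∈_ to _∈ₗ_)
  import Data.List.Membership.Propositional.Properties as ∈
  open import Data.List.Relation.Unary.Any as Any using (here; there)
  open import Data.List.Relation.Unary.All as All using (All; []; _∷_)
  open import Data.List.Relation.Unary.AllPairs using ([]; _∷_)
  open import Data.List.Relation.Unary.Unique.Propositional using (Unique)
  import Data.List.Relation.Unary.Unique.Propositional.Properties as Unique
  open import Data.Product using (_,_)
  open import Data.Nat.ListAction using (sum)
  open import Data.Nat.ListAction.Properties using (sum-++)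
  open import Data.Empty using (⊥-elim)
  open import Algebra.Properties.CommutativeSemigroup ℕ.+-commutativeSemigroup
    using () renaming (interchange to +-interchange)
  open import Relation.Binary using (tri<; tri≈; tri>)
  open import Relation.Binary.PropositionalEquality

  private variable
    A B : Set

  𝟙 : Bool → ℕ
  𝟙 b = if b then 1 else 0

  Σ : (A → ℕ) → List A → ℕ
  Σ f xs = sum (map f xs)

  Σ-mono-≤ : ∀ {f g : A → ℕ} xs → (∀ x → x ∈ₗ xs → f x ≤ g x) → Σ f xs ≤ Σ g xs
  Σ-mono-≤ []       f≤g = z≤n
  Σ-mono-≤ (x ∷ xs) f≤g = ℕ.+-mono-≤ (f≤g x (here refl)) (Σ-mono-≤ xs (λ y y∈ → f≤g y (there y∈)))

  Σ-cong : ∀ {f g : A → ℕ} xs → (∀ x → f x ≡ g x) → Σ f xs ≡ Σ g xs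
  Σ-cong []       f≗g = refl
  Σ-cong (x ∷ xs) f≗g = cong₂ _+_ (f≗g x) (Σ-cong xs f≗g)

  Σ-+ : ∀ (f g : A → ℕ) xs → Σ (λ x → f x + g x) xs ≡ Σ f xs + Σ g xs
  Σ-+ f g []       = refl
  Σ-+ f g (x ∷ xs) rewrite Σ-+ f g xs = +-interchange (f x) (g x) (Σ f xs) (Σ g xs)

  Σ-* : ∀ c (f : A → ℕ) xs → Σ (λ x → c * f x) xs ≡ c * Σ f xs
  Σ-* c f []       = sym (ℕ.*-zeroʳ c)
  Σ-* c f (x ∷ xs) rewrite Σ-* c f xs = sym (ℕ.*-distribˡ-+ c (f x) (Σ f xs))

  Σ-const : ∀ c (xs : List A) → Σ (λ _ → c) xs ≡ length xs * c
  Σ-const c []       = refl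
  Σ-const c (x ∷ xs) = cong (c +_) (Σ-const c xs)

  Σ-++ : ∀ (f : A → ℕ) xs ys → Σ f (xs ++ ys) ≡ Σ f xs + Σ f ys
  Σ-++ f xs ys = trans (cong sum (List.map-++ f xs ys)) (sum-++ (map f xs) (map f ys))

  Σ-swap : ∀ (f : A → B → ℕ) xs ys → Σ (λ x → Σ (f x) ys) xs ≡ Σ (λ y → Σ (λ x → f x y) xs) ys
  Σ-swap f []       ys = sym (trans (Σ-const 0 ys) (ℕ.*-zeroʳ (length ys)))
  Σ-swap f (x ∷ xs) ys rewrite Σ-swap f xs ys = sym (Σ-+ (f x) (λ y → Σ (λ x → f x y) xs) ys)

  Σ-lookup : ∀ (g : A → ℕ) xs → Σ (λ i → g (lookup xs i)) (allFin (length xs)) ≡ Σ g xs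
  Σ-lookup g xs = cong sum (begin
    map (λ i → g (lookup xs i)) (tabulate (λ i → i)) ≡⟨ List.map-tabulate (λ i → i) _ ⟩
    tabulate (λ i → g (lookup xs i))                 ≡⟨ List.map-tabulate (lookup xs) g ⟨
    map g (tabulate (lookup xs))                     ≡⟨ cong (map g) (List.tabulate-lookup xs) ⟩
    map g xs                                         ∎)
    where open ≡-Reasoning

  length-filterᵇ : ∀ (p : A → Bool) xs → length (filterᵇ p xs) ≡ Σ (λ x → 𝟙 (p x)) xs
  length-filterᵇ p []       = refl
  length-filterᵇ p (x ∷ xs) with p x
  ... | true  = cong suc (length-filterᵇ p xs)
  ... | false = length-filterᵇ p xs

  length-concat≤ : ∀ m (xss : List (List A)) → All (λ xs → length xs ≤ m) xss →
    length (concat xss) ≤ length xss * m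
  length-concat≤ m []         []         = z≤n
  length-concat≤ m (xs ∷ xss) (h ∷ hs) =
    ℕ.≤-trans (ℕ.≤-reflexive (List.length-++ xs)) (ℕ.+-mono-≤ h (length-concat≤ m xss hs))

  Unique-lookup-injective : ∀ (xs : List A) → Unique xs → ∀ i j → lookup xs i ≡ lookup xs j → i ≡ j
  Unique-lookup-injective (x ∷ xs) u        zero    zero    eq = refl
  Unique-lookup-injective (x ∷ xs) (x∉ ∷ u) zero    (suc j) eq = ⊥-elim (All.lookup x∉ (∈.∈-lookup j) eq)
  Unique-lookup-injective (x ∷ xs) (x∉ ∷ u) (suc i) zero    eq = ⊥-elim (All.lookup x∉ (∈.∈-lookup i) (sym eq))
  Unique-lookup-injective (x ∷ xs) (x∉ ∷ u) (suc i) (suc j) eq = cong suc (Unique-lookup-injective xs u i j eq)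

  ∈-─ : ∀ {x y : A} {ys} (x∈ys : x ∈ₗ ys) → y ∈ₗ ys → y ≢ x → y ∈ₗ (ys Any.─ x∈ys)
  ∈-─ (here refl) (here refl) y≢x = ⊥-elim (y≢x refl)
  ∈-─ (here refl) (there y∈)  y≢x = y∈
  ∈-─ (there x∈)  (here refl) y≢x = here refl
  ∈-─ (there x∈)  (there y∈)  y≢x = there (∈-─ x∈ y∈ y≢x)

  Unique-⊆⇒length≤ : ∀ (xs ys : List A) → Unique xs → (∀ x → x ∈ₗ xs → x ∈ₗ ys) → length xs ≤ length ys
  Unique-⊆⇒length≤ []       ys u          xs⊆ys = z≤n
  Unique-⊆⇒length≤ (x ∷ xs) ys (x∉xs ∷ u) xs⊆ys =
    subst (suc (length xs) ≤_) (sym (List.length-removeAt′ ys (Any.index x∈ys)))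
      (s≤s (Unique-⊆⇒length≤ xs (ys Any.─ x∈ys) u
        (λ y y∈xs → ∈-─ x∈ys (xs⊆ys y (there y∈xs)) (λ y≡x → All.lookup x∉xs y∈xs (sym y≡x)))))
    where
    x∈ys : x ∈ₗ ys
    x∈ys = xs⊆ys x (here refl)

  elements : ∀ {n} → Subset n → List (Fin n)
  elements []            = []
  elements (inside  ∷ S) = zero ∷ map suc (elements S)
  elements (outside ∷ S) = map suc (elements S)

  length-elements : ∀ {n} (S : Subset n) → length (elements S) ≡ ∣ S ∣
  length-elements []            = refl
  length-elements (inside  ∷ S) = cong suc (trans (List.length-map suc (elements S)) (length-elements S))
  length-elements (outside ∷ S) = trans (List.length-map suc (elements S)) (length-elements S)

  ∈-elements⁺ : ∀ {n} {x : Fin n} (S : Subset n) → x ∈ S → x ∈ₗ elements S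
  ∈-elements⁺ (inside  ∷ S) here        = here refl
  ∈-elements⁺ (inside  ∷ S) (there x∈S) = there (∈.∈-map⁺ suc (∈-elements⁺ S x∈S))
  ∈-elements⁺ (outside ∷ S) (there x∈S) = ∈.∈-map⁺ suc (∈-elements⁺ S x∈S)

  ∈-elements⁻ : ∀ {n} {x : Fin n} (S : Subset n) → x ∈ₗ elements S → x ∈ S
  ∈-elements⁻ (inside  ∷ S) (here refl) = here
  ∈-elements⁻ (inside  ∷ S) (there x∈)  with ∈.∈-map⁻ suc x∈
  ... | y , y∈ , refl = there (∈-elements⁻ S y∈)
  ∈-elements⁻ (outside ∷ S) x∈          with ∈.∈-map⁻ suc x∈
  ... | y , y∈ , refl = there (∈-elements⁻ S y∈)

  Unique-elements : ∀ {n} (S : Subset n) → Unique (elements S)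
  Unique-elements []            = []
  Unique-elements (inside  ∷ S) =
    All.tabulate zero∉ ∷ Unique.map⁺ Fin.suc-injective (Unique-elements S)
    where
    zero∉ : ∀ {y} → y ∈ₗ map suc (elements S) → zero ≢ y
    zero∉ y∈ refl with ∈.∈-map⁻ suc y∈
    ... | _ , _ , ()
  Unique-elements (outside ∷ S) = Unique.map⁺ Fin.suc-injective (Unique-elements S)

  ∣∣≤length : ∀ {n} (S : Subset n) ys → (∀ x → x ∈ S → x ∈ₗ ys) → ∣ S ∣ ≤ length ys
  ∣∣≤length S ys S⊆ys = subst (_≤ length ys) (length-elements S)
    (Unique-⊆⇒length≤ (elements S) ys (Unique-elements S) (λ x x∈ → S⊆ys x (∈-elements⁻ S x∈)))

  module _ {N : ℕ} (f : Fin N → Fin N → Bool)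
           (f-sym : ∀ i j → f i j ≡ f j i) (f-irrefl : ∀ i → f i i ≡ false) where

    private
      T⇒≡true : ∀ {b} → T b → b ≡ true
      T⇒≡true = Equivalence.to T-≡

      ordered : Fin N → Fin N → ℕ
      ordered i j = 𝟙 ((toℕ i <ᵇ toℕ j) ∧ f i j)

      ≤-ordered-both-ways : ∀ i j → 𝟙 (f i j) ≤ ordered i j + ordered j i
      ≤-ordered-both-ways i j with ℕ.<-cmp (toℕ i) (toℕ j)
      ... | tri< i<j _ _ rewrite T⇒≡true (ℕ.<⇒<ᵇ i<j) = ℕ.m≤m+n _ _
      ... | tri> _ _ j<i rewrite T⇒≡true (ℕ.<⇒<ᵇ j<i) | f-sym j i = ℕ.m≤n+m _ _
      ... | tri≈ _ i≡j _ rewrite Fin.toℕ-injective i≡j | f-irrefl j = z≤n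

    handshake-≤ : Σ (λ i → Σ (λ j → 𝟙 (f i j)) (allFin N)) (allFin N) ≤
                  2 * Σ (λ i → Σ (λ j → 𝟙 ((toℕ i <ᵇ toℕ j) ∧ f i j)) (allFin N)) (allFin N)
    handshake-≤ = begin
      Σ (λ i → Σ (λ j → 𝟙 (f i j)) F) F
        ≤⟨ Σ-mono-≤ F (λ i _ → Σ-mono-≤ F (λ j _ → ≤-ordered-both-ways i j)) ⟩
      Σ (λ i → Σ (λ j → ordered i j + ordered j i) F) F
        ≡⟨ Σ-cong F (λ i → Σ-+ (ordered i) (λ j → ordered j i) F) ⟩
      Σ (λ i → Σ (ordered i) F + Σ (λ j → ordered j i) F) F
        ≡⟨ Σ-+ _ _ F ⟩
      Σ (λ i → Σ (ordered i) F) F + Σ (λ i → Σ (λ j → ordered j i) F) F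
        ≡⟨ cong (Σ (λ i → Σ (ordered i) F) F +_) (Σ-swap ordered F F) ⟨
      Σ (λ i → Σ (ordered i) F) F + Σ (λ i → Σ (ordered i) F) F
        ≡⟨ cong (Σ (λ i → Σ (ordered i) F) F +_) (ℕ.+-identityʳ _) ⟨
      2 * Σ (λ i → Σ (ordered i) F) F ∎
      where
      open ℕ.≤-Reasoning
      F : List (Fin N)
      F = allFin N


module Arithmetic where

  open import Data.Nat using (zero; suc; _+_; _*_; _^_; _≤_; z≤n; s≤s; NonZero; >-nonZero)
  open import Data.Nat.Properties
  open import Data.Nat.Tactic.RingSolver using (solve-∀)
  open import Data.Empty using (⊥-elim)
  open import Relation.Binary.PropositionalEquality using (_≡_; refl; sym; trans; cong; subst)

  ^-distribʳ-* : ∀ m n o → (m * n) ^ o ≡ m ^ o * n ^ o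
  ^-distribʳ-* m n zero    = refl
  ^-distribʳ-* m n (suc o) rewrite ^-distribʳ-* m n o = lemma m n (m ^ o) (n ^ o)
    where
    lemma : ∀ m n x y → m * n * (x * y) ≡ m * x * (n * y)
    lemma = solve-∀

  2a+2B≤Bs⇒1≤s : ∀ a B s .{{_ : NonZero B}} → 2 * a + 2 * B ≤ B * s → 1 ≤ s
  2a+2B≤Bs⇒1≤s a (suc B) zero    le rewrite *-zeroʳ B =
    ⊥-elim (<⇒≱ (s≤s z≤n) (≤-trans (m≤n+m (2 * suc B) (2 * a)) le))
  2a+2B≤Bs⇒1≤s a B       (suc s) le = s≤s z≤n

  4a³+B³≤sB³⇒2a+2B≤Bs : ∀ a B s .{{_ : NonZero B}} → B ≤ a →
    4 * (a * a * a) + B * B * B ≤ s * (B * B * B) → 2 * a + 2 * B ≤ B * s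
  4a³+B³≤sB³⇒2a+2B≤Bs a B s B≤a le = *-cancelˡ-≤ (B * B) {{m*n≢0 B B}} (begin
    B * B * (2 * a + 2 * B)                   ≡⟨ expand a B ⟩
    2 * (a * (B * B)) + B * B * B + B * B * B
      ≤⟨ +-monoˡ-≤ (B * B * B) (+-mono-≤ (*-monoʳ-≤ 2 (*-monoʳ-≤ a (*-mono-≤ B≤a B≤a)))
                                         (*-mono-≤ (*-mono-≤ B≤a B≤a) B≤a)) ⟩
    2 * (a * (a * a)) + a * a * a + B * B * B ≡⟨ cong (_+ B * B * B) (collect a) ⟩
    3 * (a * a * a) + B * B * B               ≤⟨ +-monoˡ-≤ (B * B * B) (*-monoˡ-≤ (a * a * a) (n≤1+n 3)) ⟩
    4 * (a * a * a) + B * B * B               ≤⟨ le ⟩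
    s * (B * B * B)                           ≡⟨ reassoc s B ⟩
    B * B * (B * s)                           ∎)
    where
    open ≤-Reasoning
    expand : ∀ a B → B * B * (2 * a + 2 * B) ≡ 2 * (a * (B * B)) + B * B * B + B * B * B
    expand = solve-∀
    collect : ∀ a → 2 * (a * (a * a)) + a * a * a ≡ 3 * (a * a * a)
    collect = solve-∀
    reassoc : ∀ s B → s * (B * B * B) ≡ B * B * (B * s)
    reassoc = solve-∀

  2a²+B²W≤2aBc : ∀ a B W s c → W * B ≤ a * s → 2 * a + 2 * B ≤ B * s → s ≤ 1 + c →
    2 * (a * a) + B * B * W ≤ 2 * a * B * c
  2a²+B²W≤2aBc a B W s c WB≤as 2a+2B≤Bs s≤1+c = begin
    2 * (a * a) + B * B * W   ≡⟨ cong (2 * (a * a) +_) (reassocW B W) ⟩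
    2 * (a * a) + B * (W * B) ≤⟨ +-monoʳ-≤ (2 * (a * a)) (*-monoʳ-≤ B WB≤as) ⟩
    2 * (a * a) + B * (a * s) ≡⟨ factor a B s ⟩
    a * (2 * a + B * s)       ≤⟨ *-monoʳ-≤ a 2a+Bs≤2Bc ⟩
    a * (2 * B * c)           ≡⟨ reassoc a B c ⟩
    2 * a * B * c             ∎
    where
    open ≤-Reasoning
    reassocW : ∀ B W → B * B * W ≡ B * (W * B)
    reassocW = solve-∀
    factor : ∀ a B s → 2 * (a * a) + B * (a * s) ≡ a * (2 * a + B * s)
    factor = solve-∀
    reassoc : ∀ a B c → a * (2 * B * c) ≡ 2 * a * B * c
    reassoc = solve-∀
    shuffle : ∀ a B s → 2 * a + 2 * B + B * s ≡ 2 * B + (2 * a + B * s)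
    shuffle = solve-∀
    double : ∀ B s → B * s + B * s ≡ 2 * B * s
    double = solve-∀
    expand : ∀ B c → 2 * B * (1 + c) ≡ 2 * B + 2 * B * c
    expand = solve-∀
    2a+Bs≤2Bc : 2 * a + B * s ≤ 2 * B * c
    2a+Bs≤2Bc = +-cancelˡ-≤ (2 * B) _ _ (begin
      2 * B + (2 * a + B * s) ≡⟨ shuffle a B s ⟨
      2 * a + 2 * B + B * s   ≤⟨ +-monoˡ-≤ (B * s) 2a+2B≤Bs ⟩
      B * s + B * s           ≡⟨ double B s ⟩
      2 * B * s               ≤⟨ *-monoʳ-≤ (2 * B) s≤1+c ⟩
      2 * B * (1 + c)         ≡⟨ expand B c ⟩
      2 * B + 2 * B * c       ∎)

  [c*C^m]^B*Q^a≤c^B*P^a : ∀ c C m B a Q P → 1 ≤ C → m * B ≤ a → C * Q ≤ P →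
    (c * C ^ m) ^ B * Q ^ a ≤ c ^ B * P ^ a
  [c*C^m]^B*Q^a≤c^B*P^a c C m B a Q P 1≤C mB≤a CQ≤P = begin
    (c * C ^ m) ^ B * Q ^ a
      ≡⟨ cong (_* Q ^ a) (trans (^-distribʳ-* c (C ^ m) B) (cong (c ^ B *_) (^-*-assoc C m B))) ⟩
    c ^ B * C ^ (m * B) * Q ^ a
      ≤⟨ *-monoˡ-≤ (Q ^ a) (*-monoʳ-≤ (c ^ B) (^-monoʳ-≤ C {{>-nonZero 1≤C}} mB≤a)) ⟩
    c ^ B * C ^ a * Q ^ a
      ≡⟨ trans (*-assoc (c ^ B) (C ^ a) (Q ^ a)) (cong (c ^ B *_) (sym (^-distribʳ-* C Q a))) ⟩
    c ^ B * (C * Q) ^ a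
      ≤⟨ *-monoʳ-≤ (c ^ B) (^-monoˡ-≤ a CQ≤P) ⟩
    c ^ B * P ^ a ∎
    where open ≤-Reasoning

  2a*[2a²]^a*B^[2a+B]≤[2a]^[2a+B]*B^B*[B²]^a : ∀ a B →
    (2 * a) ^ B * (2 * (a * a)) ^ a * B ^ (2 * a + B) ≤ (2 * a) ^ (2 * a + B) * (B ^ B * (B * B) ^ a)
  2a*[2a²]^a*B^[2a+B]≤[2a]^[2a+B]*B^B*[B²]^a a B = begin
    (2 * a) ^ B * (2 * (a * a)) ^ a * B ^ (2 * a + B)
      ≡⟨ cong ((2 * a) ^ B * (2 * (a * a)) ^ a *_) (^-2a+B B) ⟩
    (2 * a) ^ B * (2 * (a * a)) ^ a * ((B * B) ^ a * B ^ B)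
      ≤⟨ *-monoˡ-≤ _ (*-monoʳ-≤ ((2 * a) ^ B) (^-monoˡ-≤ a 2a²≤[2a]²)) ⟩
    (2 * a) ^ B * ((2 * a) * (2 * a)) ^ a * ((B * B) ^ a * B ^ B)
      ≡⟨ rearrange ((2 * a) ^ B) (((2 * a) * (2 * a)) ^ a) ((B * B) ^ a) (B ^ B) ⟩
    ((2 * a) * (2 * a)) ^ a * (2 * a) ^ B * (B ^ B * (B * B) ^ a)
      ≡⟨ cong (_* (B ^ B * (B * B) ^ a)) (^-2a+B (2 * a)) ⟨
    (2 * a) ^ (2 * a + B) * (B ^ B * (B * B) ^ a) ∎
    where
    open ≤-Reasoning
    ^-2a+B : ∀ x → x ^ (2 * a + B) ≡ (x * x) ^ a * x ^ B
    ^-2a+B x = trans (^-distribˡ-+-* x (2 * a) B)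
      (cong (_* x ^ B) (trans (sym (^-*-assoc x 2 a)) (cong (λ y → (x * y) ^ a) (*-identityʳ x))))
    2a²≤[2a]² : 2 * (a * a) ≤ (2 * a) * (2 * a)
    2a²≤[2a]² = subst (2 * (a * a) ≤_) (double a) (m≤m+n (2 * (a * a)) (2 * (a * a)))
      where
      double : ∀ a → 2 * (a * a) + 2 * (a * a) ≡ (2 * a) * (2 * a)
      double = solve-∀
    rearrange : ∀ x y z w → x * y * (z * w) ≡ y * x * (w * z)
    rearrange = solve-∀


module SequenceTree where

  open Counting using (length-concat≤)
  open import Data.Nat using (ℕ; zero; suc; _+_; _*_; _^_; _≤_; z≤n; s≤s)
  open import Data.Nat.Properties
  open import Data.List using (List; []; _∷_; map; length; concatMap)
  open import Data.List.Properties using (length-map)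
  open import Data.List.Membership.Propositional using () renaming (_∈_ to _∈ₗ_)
  open import Data.List.Membership.Propositional.Properties using (∈-map⁺; ∈-concat⁺′)
  open import Data.List.Relation.Unary.Any using (here; there)
  open import Data.List.Relation.Unary.All as All using (All; []; _∷_)
  import Data.List.Relation.Unary.All.Properties as All
  open import Data.Product using (_×_; _,_)
  open import Data.Unit using (⊤)
  open import Relation.Binary.PropositionalEquality using (refl; cong)

  treeSize : ℕ → ℕ → ℕ
  treeSize C zero    = 1
  treeSize C (suc m) = 1 + C * treeSize C m

  treeSize<2*C^m : ∀ {C} → 2 ≤ C → ∀ m → suc (treeSize C m) ≤ 2 * C ^ m
  treeSize<2*C^m 2≤C zero    = ≤-refl
  treeSize<2*C^m {C} 2≤C (suc m) = begin
    2 + C * T          ≤⟨ +-monoˡ-≤ (C * T) 2≤C ⟩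
    C + C * T          ≡⟨ *-suc C T ⟨
    C * suc T          ≤⟨ *-monoʳ-≤ C (treeSize<2*C^m 2≤C m) ⟩
    C * (2 * C ^ m)    ≡⟨ *-comm C (2 * C ^ m) ⟩
    2 * C ^ m * C      ≡⟨ *-assoc 2 (C ^ m) C ⟩
    2 * (C ^ m * C)    ≡⟨ cong (2 *_) (*-comm (C ^ m) C) ⟩
    2 * C ^ suc m      ∎
    where
    open ≤-Reasoning
    T : ℕ
    T = treeSize C m

  module _ {S A : Set} (next : S → A → S) (options : S → List A) where

    Admissible : S → List A → Set
    Admissible s []       = ⊤
    Admissible s (x ∷ xs) = x ∈ₗ options s × Admissible (next s x) xs

    sequences : S → ℕ → List (List A)
    sequences s zero    = [] ∷ []
    sequences s (suc m) = [] ∷ concatMap (λ x → map (x ∷_) (sequences (next s x) m)) (options s)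

    private
      extensions : S → ℕ → A → List (List A)
      extensions s m x = map (x ∷_) (sequences (next s x) m)

    ∈-sequences : ∀ s m xs → Admissible s xs → length xs ≤ m → xs ∈ₗ sequences s m
    ∈-sequences s zero    []       _          _          = here refl
    ∈-sequences s (suc m) []       _          _          = here refl
    ∈-sequences s (suc m) (x ∷ xs) (x∈ , adm) (s≤s len≤) =
      there (∈-concat⁺′ (∈-map⁺ (x ∷_) (∈-sequences (next s x) m xs adm len≤))
                        (∈-map⁺ (extensions s m) x∈))

    sequences-length≤ : ∀ s m → All (λ xs → length xs ≤ m) (sequences s m)
    sequences-length≤ s zero    = z≤n ∷ []
    sequences-length≤ s (suc m) = z≤n ∷ All.concat⁺ (All.map⁺ {xs = options s} {f = extensions s m}
      (All.tabulate λ {x} _ → All.map⁺ {f = x ∷_} (All.map s≤s (sequences-length≤ (next s x) m))))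

    length-sequences≤treeSize : ∀ {C} → (∀ s → length (options s) ≤ C) →
      ∀ s m → length (sequences s m) ≤ treeSize C m
    length-sequences≤treeSize options≤ s zero    = ≤-refl
    length-sequences≤treeSize {C} options≤ s (suc m) = s≤s (begin
      length (concatMap (extensions s m) (options s))
        ≤⟨ length-concat≤ (treeSize C m) (map (extensions s m) (options s)) (All.map⁺ (All.tabulate λ {x} _ →
             ≤-trans (≤-reflexive (length-map (x ∷_) (sequences (next s x) m)))
                     (length-sequences≤treeSize options≤ (next s x) m))) ⟩
      length (map (extensions s m) (options s)) * treeSize C m
        ≡⟨ cong (_* treeSize C m) (length-map _ (options s)) ⟩
      length (options s) * treeSize C m
        ≤⟨ *-monoˡ-≤ (treeSize C m) (options≤ s) ⟩
      C * treeSize C m ∎)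
      where open ≤-Reasoning


module InducedMinor where

  open import Defs
  open Counting
  open import Data.Bool using (Bool; true; false; _∧_; T)
  open import Data.Bool.Properties using (T-≡; T-∧)
  open import Data.Nat as ℕ using (ℕ; _*_; _≤_)
  import Data.Nat.Properties as ℕ
  open import Data.Fin using (Fin; toℕ)
  open import Data.Fin.Subset using (Subset; _∈_; ⁅_⁆)
  open import Data.Fin.Subset.Properties using (x∈⁅x⁆; x∈⁅y⁆⇒x≡y; p⊆p∪q)
  open import Data.Vec using (lookup)
  open import Data.Vec.Properties using ([]=⇒lookup; lookup⇒[]=)
  open import Data.List as List using (List; length; allFin)
  open import Data.List.Membership.Propositional using (lose)
  open import Data.List.Membership.Propositional.Properties using (∈-allFin)
  open import Data.List.Relation.Unary.Any using (satisfied)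
  open import Data.List.Relation.Unary.Any.Properties using (any⁺; any⁻)
  open import Data.List.Relation.Unary.Unique.Propositional using (Unique)
  open import Data.Product using (_,_)
  open import Data.Unit using (tt)
  open import Data.Empty using (⊥-elim)
  open import Function.Bundles using (Equivalence)
  open import Relation.Binary.PropositionalEquality

  private
    T-injective : ∀ {x y} → (T x → T y) → (T y → T x) → x ≡ y
    T-injective {false} {false} _ _ = refl
    T-injective {false} {true}  _ g = ⊥-elim (g tt)
    T-injective {true}  {false} f _ = ⊥-elim (f tt)
    T-injective {true}  {true}  _ _ = refl

    T-lookup⇒∈ : ∀ {n} {p : Subset n} {x} → T (lookup p x) → x ∈ p
    T-lookup⇒∈ {p = p} {x} t = lookup⇒[]= x p (Equivalence.to T-≡ t)

    ∈⇒T-lookup : ∀ {n} {p : Subset n} {x} → x ∈ p → T (lookup p x)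
    ∈⇒T-lookup x∈p = Equivalence.from T-≡ ([]=⇒lookup x∈p)

  module _ (G : Graph) where
    open Graph G renaming (sym to adj-sym)

    degreeIn : List (Fin n) → Fin n → ℕ
    degreeIn xs z = Σ (λ x → 𝟙 (adj z x)) xs

    degreeSum : List (Fin n) → ℕ
    degreeSum xs = Σ (degreeIn xs) xs

    module _ (xs : List (Fin n)) (xs-unique : Unique xs) where

      private
        c : Fin (length xs) → Fin n
        c = List.lookup xs

      singletonModel : Shallow1Model G (length xs)
      singletonModel = record
        { center   = c
        ; branch   = λ i → ⁅ c i ⁆
        ; center∈  = λ i → x∈⁅x⁆ (c i)
        ; star     = λ i → p⊆p∪q (N G (c i))
        ; disjoint = λ i j i≢j u u∈i u∈j → i≢j (Unique-lookup-injective xs xs-unique i j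
                       (trans (sym (x∈⁅y⁆⇒x≡y (c i) u∈i)) (x∈⁅y⁆⇒x≡y (c j) u∈j)))
        }

      hasEdge-singletonModel : ∀ i j → hasEdge G singletonModel i j ≡ adj (c i) (c j)
      hasEdge-singletonModel i j = T-injective edge⇒adj adj⇒edge
        where
        edge⇒adj : T (hasEdge G singletonModel i j) → T (adj (c i) (c j))
        edge⇒adj t =
          let u , t′  = satisfied (any⁻ _ (allFin n) t)
              w , t″  = satisfied (any⁻ _ (allFin n) t′)
              u∈ , t‴ = Equivalence.to T-∧ t″
              w∈ , uw = Equivalence.to (T-∧ {lookup ⁅ c j ⁆ w}) t‴
          in subst₂ (λ x y → T (adj x y))
               (x∈⁅y⁆⇒x≡y (c i) (T-lookup⇒∈ u∈)) (x∈⁅y⁆⇒x≡y (c j) (T-lookup⇒∈ w∈)) uw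

        adj⇒edge : T (adj (c i) (c j)) → T (hasEdge G singletonModel i j)
        adj⇒edge t = any⁺ _ (lose (∈-allFin (c i)) (any⁺ _ (lose (∈-allFin (c j))
          (Equivalence.from T-∧ (∈⇒T-lookup (x∈⁅x⁆ (c i)) ,
           Equivalence.from T-∧ (∈⇒T-lookup (x∈⁅x⁆ (c j)) , t))))))

      degreeSum≤2*edgeCount : degreeSum xs ≤ 2 * edgeCount G singletonModel
      degreeSum≤2*edgeCount = begin
        degreeSum xs
          ≡⟨ Σ-lookup (degreeIn xs) xs ⟨
        Σ (λ i → degreeIn xs (c i)) F
          ≡⟨ Σ-cong F (λ i → Σ-lookup (λ y → 𝟙 (adj (c i) y)) xs) ⟨
        Σ (λ i → Σ (λ j → 𝟙 (adj (c i) (c j))) F) F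
          ≤⟨ handshake-≤ (λ i j → adj (c i) (c j)) (λ i j → adj-sym (c i) (c j)) (λ i → irrefl (c i)) ⟩
        2 * Σ (λ i → Σ (λ j → 𝟙 (lt i j ∧ adj (c i) (c j))) F) F
          ≡⟨ cong (2 *_) (Σ-cong F λ i → Σ-cong F λ j → cong (λ b → 𝟙 (lt i j ∧ b)) (hasEdge-singletonModel i j)) ⟨
        2 * edgeCount G singletonModel ∎
        where
        open ℕ.≤-Reasoning
        F : List (Fin (length xs))
        F = allFin (length xs)
        lt : Fin (length xs) → Fin (length xs) → Bool
        lt i j = toℕ i ℕ.<ᵇ toℕ j


module StrongVertices where

  open import Defs
  open Counting
  open InducedMinor
  open Arithmetic using (2a+2B≤Bs⇒1≤s; 2a²+B²W≤2aBc)
  open import Data.Bool using (true)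
  open import Data.Nat as ℕ using (ℕ; suc; _+_; _*_; _≤_; z≤n; NonZero)
  import Data.Nat.Properties as ℕ
  open import Data.Nat.Tactic.RingSolver using (solve-∀)
  open import Data.Fin using (Fin)
  import Data.Fin.Properties as Fin
  open import Data.Fin.Subset using (Subset; _∈_; _∩_; ∣_∣; ⁅_⁆)
  open import Data.Fin.Subset.Properties using (x∈p∩q⁻; x∈p∪q⁻; x∈⁅y⁆⇒x≡y; ∣p∩q∣≤∣q∣)
  open import Data.Vec.Properties using ([]=⇒lookup; lookup∘tabulate)
  open import Data.List as List using (List; []; _∷_; length; _++_; filter; filterᵇ)
  import Data.List.Properties as List
  open import Data.List.Membership.Propositional using () renaming (_∈_ to _∈ₗ_)
  import Data.List.Membership.Propositional.Properties as ∈
  open import Data.List.Relation.Unary.Any using (here; there)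
  open import Data.List.Relation.Unary.All using ([]; _∷_)
  open import Data.List.Relation.Unary.AllPairs using ([]; _∷_)
  open import Data.List.Relation.Unary.Unique.Propositional using (Unique)
  import Data.List.Relation.Unary.Unique.Propositional.Properties as Unique
  open import Data.Product using (_×_; _,_; proj₁; proj₂)
  open import Data.Sum using (inj₁; inj₂)
  open import Function.Bundles using (Equivalence)
  open import Data.Bool.Properties using (T-≡)
  open import Relation.Nullary using (¬_; yes; no; ¬?)
  open import Relation.Unary using (Decidable)
  open import Relation.Binary.PropositionalEquality

  AvgDegree≤ : Graph → ℕ → ℕ → Set
  AvgDegree≤ G a B = ∀ m (M : Shallow1Model G (suc m)) → 2 * edgeCount G M * B ≤ a * suc m

  module _ (G : Graph) where
    open Graph G renaming (sym to adj-sym)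

    ∣Nc∩W∣≤1+degreeIn : ∀ W xs z → (∀ w → w ∈ W → w ∈ₗ xs) → ∣ Nc G z ∩ W ∣ ≤ 1 + degreeIn G xs z
    ∣Nc∩W∣≤1+degreeIn W xs z W⊆xs =
      subst (λ d → ∣ Nc G z ∩ W ∣ ≤ suc d) (length-filterᵇ (adj z) xs)
        (∣∣≤length (Nc G z ∩ W) (z ∷ filterᵇ (adj z) xs) covered)
      where
      covered : ∀ w → w ∈ Nc G z ∩ W → w ∈ₗ z ∷ filterᵇ (adj z) xs
      covered w w∈ with x∈p∩q⁻ (Nc G z) W w∈
      ... | w∈Nc , w∈W with x∈p∪q⁻ ⁅ z ⁆ (N G z) w∈Nc
      ... | inj₁ w∈⁅z⁆ = here (x∈⁅y⁆⇒x≡y z w∈⁅z⁆)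
      ... | inj₂ w∈Nz  = there (∈.∈-filter⁺ _ (W⊆xs w w∈W)
        (Equivalence.from T-≡ (trans (sym (lookup∘tabulate (adj z) w)) ([]=⇒lookup w∈Nz))))

    module Extension (W : Subset n) (zs : List (Fin n)) (zs-unique : Unique zs) where
      private
        open import Data.List.Membership.DecPropositional (Fin._≟_ {n}) using () renaming (_∈?_ to _∈ₗ?_)

        ∉zs? : Decidable (λ w → ¬ w ∈ₗ zs)
        ∉zs? w = ¬? (w ∈ₗ? zs)

        rest : List (Fin n)
        rest = filter ∉zs? (elements W)

      extended : List (Fin n)
      extended = zs ++ rest

      extended-unique : Unique extended
      extended-unique = Unique.++⁺ zs-unique (Unique.filter⁺ ∉zs? (Unique-elements W))
        (λ (w∈zs , w∈rest) → proj₂ (∈.∈-filter⁻ ∉zs? {xs = elements W} w∈rest) w∈zs)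

      ⊆extended : ∀ w → w ∈ W → w ∈ₗ extended
      ⊆extended w w∈W with w ∈ₗ? zs
      ... | yes w∈zs = ∈.∈-++⁺ˡ w∈zs
      ... | no  w∉zs = ∈.∈-++⁺ʳ zs (∈.∈-filter⁺ ∉zs? (∈-elements⁺ W w∈W) w∉zs)

      length-extended≤ : length extended ≤ length zs + ∣ W ∣
      length-extended≤ = begin
        length (zs ++ rest)     ≡⟨ List.length-++ zs ⟩
        length zs + length rest ≤⟨ ℕ.+-monoʳ-≤ (length zs) (List.length-filter ∉zs? (elements W)) ⟩
        length zs + length (elements W) ≡⟨ cong (length zs +_) (length-elements W) ⟩
        length zs + ∣ W ∣       ∎
        where open ℕ.≤-Reasoning

    module _ {a B : ℕ} {{_ : NonZero B}} (avg≤ : AvgDegree≤ G a B) where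

      degreeSum*B≤a*length : ∀ xs → Unique xs → degreeSum G xs * B ≤ a * length xs
      degreeSum*B≤a*length []       _ = z≤n
      degreeSum*B≤a*length (x ∷ xs) u = ℕ.≤-trans
        (ℕ.*-monoˡ-≤ B (degreeSum≤2*edgeCount G (x ∷ xs) u)) (avg≤ (length xs) (singletonModel G (x ∷ xs) u))

      edge⇒B≤a : ∀ {v u} → adj v u ≡ true → B ≤ a
      edge⇒B≤a {v} {u} vu = ℕ.*-cancelʳ-≤ B a 2
        (subst (_≤ a * 2) (trans (cong (_* B) degreeSum≡2) (ℕ.*-comm 2 B))
          (degreeSum*B≤a*length (v ∷ u ∷ []) ((v≢u ∷ []) ∷ [] ∷ [])))
        where
        v≢u : v ≢ u
        v≢u refl with () ← trans (sym vu) (irrefl v)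
        degreeSum≡2 : degreeSum G (v ∷ u ∷ []) ≡ 2
        degreeSum≡2 rewrite irrefl v | irrefl u | vu | adj-sym u v | vu = refl

      length-strong≤2k² : ∀ W zs → Unique zs →
        (∀ z → z ∈ₗ zs → ∣ W ∣ * B ≤ a * ∣ Nc G z ∩ W ∣ × 2 * a + 2 * B ≤ B * ∣ Nc G z ∩ W ∣) →
        length zs * (B * B) ≤ 2 * (a * a)
      length-strong≤2k² W []       _         _      = z≤n
      length-strong≤2k² W (z ∷ zs) zs-unique strong =
        ℕ.*-cancelʳ-≤ _ _ ∣ W ∣ {{ℕ.>-nonZero 1≤∣W∣}} (ℕ.+-cancelˡ-≤ (A * t) _ _ (begin
          A * t + t * (B * B) * ∣ W ∣        ≡⟨ factor A t B ∣ W ∣ ⟩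
          t * (A + B * B * ∣ W ∣)            ≡⟨ Σ-const _ (z ∷ zs) ⟨
          Σ (λ _ → A + B * B * ∣ W ∣) (z ∷ zs) ≤⟨ Σ-mono-≤ (z ∷ zs) per-vertex ⟩
          Σ (λ y → 2 * a * B * deg y) (z ∷ zs) ≡⟨ Σ-* (2 * a * B) deg (z ∷ zs) ⟩
          2 * a * B * Σ deg (z ∷ zs)         ≤⟨ ℕ.*-monoʳ-≤ (2 * a * B) Σdeg≤degreeSum ⟩
          2 * a * B * degreeSum G xs         ≡⟨ reassoc a B (degreeSum G xs) ⟩
          2 * a * (degreeSum G xs * B)       ≤⟨ ℕ.*-monoʳ-≤ (2 * a) (degreeSum*B≤a*length xs extended-unique) ⟩
          2 * a * (a * length xs)            ≤⟨ ℕ.*-monoʳ-≤ (2 * a) (ℕ.*-monoʳ-≤ a length-extended≤) ⟩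
          2 * a * (a * (t + ∣ W ∣))          ≡⟨ expand a t ∣ W ∣ ⟩
          A * t + A * ∣ W ∣                  ∎))
        where
        open ℕ.≤-Reasoning
        open Extension W (z ∷ zs) zs-unique
        A t : ℕ
        A = 2 * (a * a)
        t = length (z ∷ zs)
        xs : List (Fin n)
        xs = extended
        deg : Fin n → ℕ
        deg = degreeIn G xs
        s : Fin n → ℕ
        s y = ∣ Nc G y ∩ W ∣
        1≤∣W∣ : 1 ≤ ∣ W ∣
        1≤∣W∣ = ℕ.≤-trans (2a+2B≤Bs⇒1≤s a B (s z) (proj₂ (strong z (here refl)))) (∣p∩q∣≤∣q∣ (Nc G z) W)
        per-vertex : ∀ y → y ∈ₗ z ∷ zs → A + B * B * ∣ W ∣ ≤ 2 * a * B * deg y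
        per-vertex y y∈ = 2a²+B²W≤2aBc a B ∣ W ∣ (s y) (deg y) (proj₁ (strong y y∈)) (proj₂ (strong y y∈))
                            (∣Nc∩W∣≤1+degreeIn W xs y ⊆extended)
        Σdeg≤degreeSum : Σ deg (z ∷ zs) ≤ degreeSum G xs
        Σdeg≤degreeSum = subst (Σ deg (z ∷ zs) ≤_) (sym (Σ-++ deg (z ∷ zs) _)) (ℕ.m≤m+n _ _)
        factor : ∀ A t B W → A * t + t * (B * B) * W ≡ t * (A + B * B * W)
        factor = solve-∀
        reassoc : ∀ a B D → 2 * a * B * D ≡ 2 * a * (D * B)
        reassoc = solve-∀
        expand : ∀ a t W → 2 * a * (a * (t + W)) ≡ 2 * (a * a) * t + 2 * (a * a) * W
        expand = solve-∀


module PseudoCovers where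

  open import Defs
  open Fraction
  open Counting using (Unique-⊆⇒length≤; ∣∣≤length; length-concat≤)
  open StrongVertices
  open SequenceTree
  open Arithmetic
  open import Data.Bool using (true)
  open import Data.Nat as ℕ using (ℕ; suc; _+_; _*_; _^_; z≤n; s≤s; NonZero)
  import Data.Nat.Properties as ℕ
  import Data.Nat.DivMod as ℕ
  open import Data.Nat.Tactic.RingSolver using (solve-∀)
  open import Data.Integer using (+_)
  open import Data.Rational as ℚ using (ℚ; _/_; _≤_; _<_; 1ℚ) renaming (_*_ to _*ℚ_)
  import Data.Rational.Properties as ℚ
  open import Data.Fin using (Fin)
  open import Data.Fin.Subset using (Subset; _∈_; _─_; _∩_; ∣_∣; Nonempty)
  open import Data.Fin.Subset.Properties using (nonempty?; Empty-unique; ∣⊥∣≡0)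
  open import Data.Vec.Properties using ([]=⇒lookup; lookup∘tabulate)
  open import Data.List using (List; []; _∷_; length; filter; allFin; concat)
  open import Data.List.Membership.Propositional using () renaming (_∈_ to _∈ₗ_)
  import Data.List.Membership.Propositional.Properties as ∈
  open import Data.List.Relation.Unary.All as All using (All)
  open import Data.List.Relation.Unary.Unique.Propositional using (Unique)
  import Data.List.Relation.Unary.Unique.Propositional.Properties as Unique
  open import Data.Product using (_×_; _,_; proj₁; proj₂)
  open import Data.Unit using (tt)
  open import Relation.Nullary using (yes; no; _×-dec_)
  open import Relation.Unary using (Decidable)
  open import Relation.Binary.PropositionalEquality

  m*n≤o⇒m≤o/n : ∀ m n o .{{_ : NonZero n}} → m * n ℕ.≤ o → m ℕ.≤ o ℕ./ n
  m*n≤o⇒m≤o/n m n o le = ℕ.≤-trans (ℕ.≤-reflexive (sym (ℕ.m*n/n≡m m n))) (ℕ./-monoˡ-≤ n le)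

  1≤∣p∣⇒Nonempty : ∀ {n} (p : Subset n) → 1 ℕ.≤ ∣ p ∣ → Nonempty p
  1≤∣p∣⇒Nonempty {n} p 1≤∣p∣ with nonempty? p
  ... | yes ne = ne
  ... | no ¬ne with () ← ℕ.≤-trans 1≤∣p∣ (ℕ.≤-reflexive (trans (cong ∣_∣ (Empty-unique ¬ne)) (∣⊥∣≡0 n)))

  module _ (G : Graph) (d : ℚ) (density≤d : ∀ m (M : Shallow1Model G (suc m)) → density G M ≤ d)
           (a b : ℕ) (a/B≡k : (+ a) / suc b ≡ kk G d) where
    open Graph G using (n; adj)

    private
      B : ℕ
      B = suc b

      k≡a/B : kk G d ≡ a /ℕ B
      k≡a/B = sym a/B≡k

    avgDegree≤ : AvgDegree≤ G a B
    avgDegree≤ m M = /ℕ-≤⇒ (2 * edgeCount G M) (suc m) a B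
      (subst₂ _≤_ (ℕ→ℚ-*-/ℕ 2 (edgeCount G M) (suc m)) k≡a/B (ℚ.*-monoˡ-≤-nonNeg (ℕ→ℚ 2) (density≤d m M)))

    Strong⇒∣W∣*B≤a*∣Nc∩W∣ : ∀ W z → Strong G d W z → ∣ W ∣ * B ℕ.≤ a * ∣ Nc G z ∩ W ∣
    Strong⇒∣W∣*B≤a*∣Nc∩W∣ W z strong = subst (∣ W ∣ * B ℕ.≤_) (ℕ.*-identityʳ _)
      (/ℕ-≤⇒ ∣ W ∣ 1 (a * s) B (subst (ℕ→ℚ ∣ W ∣ ≤_) k*s≡ strong))
      where
      s : ℕ
      s = ∣ Nc G z ∩ W ∣
      k*s≡ : kk G d *ℚ ℕ→ℚ s ≡ (a * s) /ℕ B
      k*s≡ = trans (cong (_*ℚ ℕ→ℚ s) k≡a/B) (/ℕ-*-ℕ→ℚ a B s)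

    ℓ≡[4a³+B³]/B³ : ℓℓ G d ≡ (4 * (a * a * a) + B * B * B) /ℕ (B * B * B)
    ℓ≡[4a³+B³]/B³ = begin
      ℕ→ℚ 4 *ℚ kk G d ^ℚ 3 ℚ.+ 1ℚ             ≡⟨ cong (λ k → ℕ→ℚ 4 *ℚ k ^ℚ 3 ℚ.+ 1ℚ) k≡a/B ⟩
      ℕ→ℚ 4 *ℚ (a /ℕ B) ^ℚ 3 ℚ.+ 1ℚ           ≡⟨ cong (λ k → ℕ→ℚ 4 *ℚ k ℚ.+ 1ℚ) (/ℕ-^ a B 3) ⟩
      ℕ→ℚ 4 *ℚ (a ^ 3) /ℕ (B ^ 3) ℚ.+ 1ℚ      ≡⟨ cong (ℚ._+ 1ℚ) (ℕ→ℚ-*-/ℕ 4 (a ^ 3) (B ^ 3)) ⟩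
      (4 * a ^ 3) /ℕ (B ^ 3) ℚ.+ 1 /ℕ 1       ≡⟨ /ℕ-+ (4 * a ^ 3) (B ^ 3) 1 1 ⟩
      (4 * a ^ 3 * 1 + 1 * B ^ 3) /ℕ (B ^ 3 * 1)
        ≡⟨ ≡⇒/ℕ-≡ (4 * a ^ 3 * 1 + 1 * B ^ 3) (B ^ 3 * 1) (4 * (a * a * a) + B * B * B) (B * B * B) (cross a B) ⟩
      (4 * (a * a * a) + B * B * B) /ℕ (B * B * B) ∎
      where
      open ≡-Reasoning
      cross : ∀ a B → (4 * (a * (a * (a * 1))) * 1 + 1 * (B * (B * (B * 1)))) * (B * B * B)
                    ≡ (4 * (a * a * a) + B * B * B) * (B * (B * (B * 1)) * 1)
      cross = solve-∀

    ℓ≤⇒4a³+B³≤x*B³ : ∀ x → ℓℓ G d ≤ ℕ→ℚ x → 4 * (a * a * a) + B * B * B ℕ.≤ x * (B * B * B)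
    ℓ≤⇒4a³+B³≤x*B³ x ℓ≤x = subst (ℕ._≤ x * (B * B * B)) (ℕ.*-identityʳ _)
      (/ℕ-≤⇒ (4 * (a * a * a) + B * B * B) (B * B * B) x 1 (subst (_≤ ℕ→ℚ x) ℓ≡[4a³+B³]/B³ ℓ≤x))

    ≤k⇒l*B≤a : ∀ l → ℕ→ℚ l ≤ kk G d → l * B ℕ.≤ a
    ≤k⇒l*B≤a l l≤k = subst (l * B ℕ.≤_) (ℕ.*-identityʳ a) (/ℕ-≤⇒ l 1 a B (subst (ℕ→ℚ l ≤_) k≡a/B l≤k))

    B≤a : ∀ v → ℓℓ G d < ℕ→ℚ ∣ N G v ∣ → B ℕ.≤ a
    B≤a v ℓ<∣Nv∣ = edge⇒B≤a G {a} {B} avgDegree≤ (N⇒adj (proj₂ (1≤∣p∣⇒Nonempty (N G v) 1≤∣Nv∣)))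
      where
      N⇒adj : ∀ {u} → u ∈ N G v → adj v u ≡ true
      N⇒adj {u} u∈Nv = trans (sym (lookup∘tabulate (adj v) u)) ([]=⇒lookup u∈Nv)

      positive : ∀ x → 4 * (a * a * a) + B * B * B ℕ.≤ x * (B * B * B) → 1 ℕ.≤ x
      positive 0       le with () ← ℕ.≤-trans (ℕ.m≤n+m (B * B * B) (4 * (a * a * a))) le
      positive (suc x) _  = s≤s z≤n

      1≤∣Nv∣ : 1 ℕ.≤ ∣ N G v ∣
      1≤∣Nv∣ = positive ∣ N G v ∣ (ℓ≤⇒4a³+B³≤x*B³ ∣ N G v ∣ (ℚ.<⇒≤ ℓ<∣Nv∣))

    Candidate : Subset n → Fin n → Set
    Candidate W z = Strong G d W z × ℓℓ G d ≤ ℕ→ℚ ∣ Nc G z ∩ W ∣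

    candidate? : ∀ W → Decidable (Candidate W)
    candidate? W z = (ℕ→ℚ ∣ W ∣ ℚ.≤? kk G d *ℚ ℕ→ℚ ∣ Nc G z ∩ W ∣) ×-dec (ℓℓ G d ℚ.≤? ℕ→ℚ ∣ Nc G z ∩ W ∣)

    candidates : Subset n → List (Fin n)
    candidates W = filter (candidate? W) (allFin n)

    uncovered : Subset n → Fin n → Subset n
    uncovered W z = W ─ Nc G z

    maxLength maxBranching : ℕ
    maxLength    = a ℕ./ B
    maxBranching = (2 * (a * a)) ℕ./ (B * B)

    length-candidates≤ : B ℕ.≤ a → ∀ W → length (candidates W) ℕ.≤ maxBranching
    length-candidates≤ B≤a W = m*n≤o⇒m≤o/n (length (candidates W)) (B * B) (2 * (a * a))
      (length-strong≤2k² G {a} {B} avgDegree≤ W (candidates W)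
        (Unique.filter⁺ (candidate? W) (Unique.allFin⁺ n)) strong)
      where
      strong : ∀ z → z ∈ₗ candidates W →
        ∣ W ∣ * B ℕ.≤ a * ∣ Nc G z ∩ W ∣ × 2 * a + 2 * B ℕ.≤ B * ∣ Nc G z ∩ W ∣
      strong z z∈ = Strong⇒∣W∣*B≤a*∣Nc∩W∣ W z (proj₁ cand)
                  , 4a³+B³≤sB³⇒2a+2B≤Bs a B ∣ Nc G z ∩ W ∣ B≤a (ℓ≤⇒4a³+B³≤x*B³ ∣ Nc G z ∩ W ∣ (proj₂ cand))
        where
        cand : Candidate W z
        cand = proj₂ (∈.∈-filter⁻ (candidate? W) {xs = allFin n} z∈)

    2≤maxBranching : B ℕ.≤ a → 2 ℕ.≤ maxBranching
    2≤maxBranching B≤a = m*n≤o⇒m≤o/n 2 (B * B) (2 * (a * a)) (ℕ.*-monoʳ-≤ 2 (ℕ.*-mono-≤ B≤a B≤a))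

    PC⇒Admissible : ∀ W vs → PC G d W vs → Admissible uncovered candidates W vs
    PC⇒Admissible W []       _                = tt
    PC⇒Admissible W (z ∷ vs) (st , ℓ≤ , rest) =
      ∈.∈-filter⁺ (candidate? W) (∈.∈-allFin z) (st , ℓ≤) , PC⇒Admissible (uncovered W z) vs rest

    pseudoCover∈sequences : ∀ W vs → IsPseudoCover G d W vs → vs ∈ₗ sequences uncovered candidates W maxLength
    pseudoCover∈sequences W vs (len≤k , pc) = ∈-sequences uncovered candidates W maxLength vs
      (PC⇒Admissible W vs pc) (m*n≤o⇒m≤o/n (length vs) B a (≤k⇒l*B≤a (length vs) len≤k))

    length-sequences≤ : B ℕ.≤ a → ∀ W →
      length (sequences uncovered candidates W maxLength) ℕ.≤ 2 * maxBranching ^ maxLength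
    length-sequences≤ B≤a W = ℕ.≤-trans
      (length-sequences≤treeSize uncovered candidates (length-candidates≤ B≤a) W maxLength)
      (ℕ.<⇒≤ (treeSize<2*C^m (2≤maxBranching B≤a) maxLength))

    private
      P Q : ℕ
      P = 2 * (a * a)
      Q = B * B

      Q^a≢0 : NonZero (Q ^ a)
      Q^a≢0 = ℕ.m^n≢0 Q a

      B^e≢0 : ∀ e → NonZero (B ^ e)
      B^e≢0 e = ℕ.m^n≢0 B e

      B^B*Q^a≢0 : NonZero (B ^ B * Q ^ a)
      B^B*Q^a≢0 = ℕ.m*n≢0 (B ^ B) (Q ^ a) {{B^e≢0 B}} {{Q^a≢0}}

      [2k]^e≡ : ∀ e → (ℕ→ℚ 2 *ℚ kk G d) ^ℚ e ≡ _/ℕ_ ((2 * a) ^ e) (B ^ e) {{B^e≢0 e}}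
      [2k]^e≡ e = trans (cong (λ k → (ℕ→ℚ 2 *ℚ k) ^ℚ e) k≡a/B)
                        (trans (cong (_^ℚ e) (ℕ→ℚ-*-/ℕ 2 a B)) (/ℕ-^ (2 * a) B e))

      2k²≡P/Q : ℕ→ℚ 2 *ℚ kk G d ^ℚ 2 ≡ P /ℕ Q
      2k²≡P/Q = begin
        ℕ→ℚ 2 *ℚ kk G d ^ℚ 2        ≡⟨ cong (λ k → ℕ→ℚ 2 *ℚ k ^ℚ 2) k≡a/B ⟩
        ℕ→ℚ 2 *ℚ (a /ℕ B) ^ℚ 2      ≡⟨ cong (ℕ→ℚ 2 *ℚ_) (/ℕ-^ a B 2) ⟩
        ℕ→ℚ 2 *ℚ (a ^ 2) /ℕ (B ^ 2) ≡⟨ ℕ→ℚ-*-/ℕ 2 (a ^ 2) (B ^ 2) ⟩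
        (2 * a ^ 2) /ℕ (B ^ 2)      ≡⟨ ≡⇒/ℕ-≡ (2 * a ^ 2) (B ^ 2) P Q (cross a B) ⟩
        P /ℕ Q                      ∎
        where
        open ≡-Reasoning
        cross : ∀ a B → 2 * (a * (a * 1)) * (B * B) ≡ 2 * (a * a) * (B * (B * 1))
        cross = solve-∀

      [2k²]^a≡ : (ℕ→ℚ 2 *ℚ kk G d ^ℚ 2) ^ℚ a ≡ _/ℕ_ (P ^ a) (Q ^ a) {{Q^a≢0}}
      [2k²]^a≡ = trans (cong (_^ℚ a) 2k²≡P/Q) (/ℕ-^ P Q a)

      2k[2k²]^k≡ : (ℕ→ℚ 2 *ℚ kk G d) ^ℚ B *ℚ (ℕ→ℚ 2 *ℚ kk G d ^ℚ 2) ^ℚ a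
                 ≡ _/ℕ_ ((2 * a) ^ B * P ^ a) (B ^ B * Q ^ a) {{B^B*Q^a≢0}}
      2k[2k²]^k≡ = trans (cong₂ _*ℚ_ ([2k]^e≡ B) [2k²]^a≡)
                         (/ℕ-* ((2 * a) ^ B) (B ^ B) (P ^ a) (Q ^ a) {{B^e≢0 B}} {{Q^a≢0}})

    module _ (v : Fin n) (ℓ<∣Nv∣ : ℓℓ G d < ℕ→ℚ ∣ N G v ∣) where

      private
        C m : ℕ
        C = maxBranching
        m = maxLength

        1≤C : 1 ℕ.≤ C
        1≤C = ℕ.≤-trans (s≤s z≤n) (2≤maxBranching (B≤a v ℓ<∣Nv∣))

        m*B≤a : m * B ℕ.≤ a
        m*B≤a = ℕ.m/n*n≤m a B

        C*Q≤P : C * Q ℕ.≤ P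
        C*Q≤P = ℕ.m/n*n≤m P Q

        𝒮 : List (List (Fin n))
        𝒮 = sequences uncovered candidates (N G v) m

      ∣𝒯∣≤2C^m : (L : List (List (Fin n))) → Unique L → All (IsPseudoCover G d (N G v)) L →
        length L ℕ.≤ 2 * C ^ m
      ∣𝒯∣≤2C^m L L-unique pcs = ℕ.≤-trans
        (Unique-⊆⇒length≤ L 𝒮 L-unique (λ vs vs∈L → pseudoCover∈sequences (N G v) vs (All.lookup pcs vs∈L)))
        (length-sequences≤ (B≤a v ℓ<∣Nv∣) (N G v))

      ∣𝒫∣≤2C^m*m : (S : Subset n) → (∀ u → u ∈ S → InP G d v u) → ∣ S ∣ ℕ.≤ 2 * C ^ m * m
      ∣𝒫∣≤2C^m*m S S⊆𝒫 = begin
        ∣ S ∣               ≤⟨ ∣∣≤length S (concat 𝒮) S⊆⋃𝒮 ⟩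
        length (concat 𝒮)   ≤⟨ length-concat≤ m 𝒮 (sequences-length≤ uncovered candidates (N G v) m) ⟩
        length 𝒮 * m        ≤⟨ ℕ.*-monoˡ-≤ m (length-sequences≤ (B≤a v ℓ<∣Nv∣) (N G v)) ⟩
        2 * C ^ m * m       ∎
        where
        open ℕ.≤-Reasoning
        S⊆⋃𝒮 : ∀ u → u ∈ S → u ∈ₗ concat 𝒮
        S⊆⋃𝒮 u u∈S = let vs , pc , u∈vs = S⊆𝒫 u u∈S in
          ∈.∈-concat⁺′ u∈vs (pseudoCover∈sequences (N G v) vs pc)

      ∣𝒯∣≤2[2k²]^k : (L : List (List (Fin n))) → Unique L → All (IsPseudoCover G d (N G v)) L →
        ℕ→ℚ (length L) ^ℚ B ≤ ℕ→ℚ 2 ^ℚ B *ℚ (ℕ→ℚ 2 *ℚ kk G d ^ℚ 2) ^ℚ a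
      ∣𝒯∣≤2[2k²]^k L L-unique pcs = subst₂ _≤_ (sym (ℕ→ℚ-^ (length L) B)) (sym rhs≡)
        (≤⇒/ℕ-≤ (length L ^ B) 1 (2 ^ B * P ^ a) (Q ^ a) {{_}} {{Q^a≢0}}
          (subst (length L ^ B * Q ^ a ℕ.≤_) (sym (ℕ.*-identityʳ _)) (begin
            length L ^ B * Q ^ a     ≤⟨ ℕ.*-monoˡ-≤ (Q ^ a) (ℕ.^-monoˡ-≤ B (∣𝒯∣≤2C^m L L-unique pcs)) ⟩
            (2 * C ^ m) ^ B * Q ^ a  ≤⟨ [c*C^m]^B*Q^a≤c^B*P^a 2 C m B a Q P 1≤C m*B≤a C*Q≤P ⟩
            2 ^ B * P ^ a            ∎)))
        where
        open ℕ.≤-Reasoning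
        rhs≡ : ℕ→ℚ 2 ^ℚ B *ℚ (ℕ→ℚ 2 *ℚ kk G d ^ℚ 2) ^ℚ a ≡ _/ℕ_ (2 ^ B * P ^ a) (Q ^ a) {{Q^a≢0}}
        rhs≡ = trans (cong₂ _*ℚ_ (ℕ→ℚ-^ 2 B) [2k²]^a≡) (ℕ→ℚ-*-/ℕ (2 ^ B) (P ^ a) (Q ^ a) {{Q^a≢0}})

      ∣𝒫∣≤2k[2k²]^k : (S : Subset n) → (∀ u → u ∈ S → InP G d v u) →
        ℕ→ℚ ∣ S ∣ ^ℚ B ≤ (ℕ→ℚ 2 *ℚ kk G d) ^ℚ B *ℚ (ℕ→ℚ 2 *ℚ kk G d ^ℚ 2) ^ℚ a
      ∣𝒫∣≤2k[2k²]^k S S⊆𝒫 = subst₂ _≤_ (sym (ℕ→ℚ-^ ∣ S ∣ B)) (sym 2k[2k²]^k≡)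
        (≤⇒/ℕ-≤ (∣ S ∣ ^ B) 1 ((2 * a) ^ B * P ^ a) (B ^ B * Q ^ a) {{_}} {{B^B*Q^a≢0}}
          (subst (∣ S ∣ ^ B * (B ^ B * Q ^ a) ℕ.≤_) (sym (ℕ.*-identityʳ _)) (begin
            ∣ S ∣ ^ B * (B ^ B * Q ^ a)  ≡⟨ ℕ.*-assoc (∣ S ∣ ^ B) (B ^ B) (Q ^ a) ⟨
            ∣ S ∣ ^ B * B ^ B * Q ^ a    ≡⟨ cong (_* Q ^ a) (^-distribʳ-* ∣ S ∣ B B) ⟨
            (∣ S ∣ * B) ^ B * Q ^ a      ≤⟨ ℕ.*-monoˡ-≤ (Q ^ a) (ℕ.^-monoˡ-≤ B ∣S∣*B≤2a*C^m) ⟩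
            (2 * a * C ^ m) ^ B * Q ^ a  ≤⟨ [c*C^m]^B*Q^a≤c^B*P^a (2 * a) C m B a Q P 1≤C m*B≤a C*Q≤P ⟩
            (2 * a) ^ B * P ^ a          ∎)))
        where
        open ℕ.≤-Reasoning
        ∣S∣*B≤2a*C^m : ∣ S ∣ * B ℕ.≤ 2 * a * C ^ m
        ∣S∣*B≤2a*C^m = begin
          ∣ S ∣ * B             ≤⟨ ℕ.*-monoˡ-≤ B (∣𝒫∣≤2C^m*m S S⊆𝒫) ⟩
          2 * C ^ m * m * B     ≡⟨ ℕ.*-assoc (2 * C ^ m) m B ⟩
          2 * C ^ m * (m * B)   ≤⟨ ℕ.*-monoʳ-≤ (2 * C ^ m) m*B≤a ⟩
          2 * C ^ m * a         ≡⟨ reorder (C ^ m) a ⟩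
          2 * a * C ^ m         ∎
          where
          reorder : ∀ x a → 2 * x * a ≡ 2 * a * x
          reorder = solve-∀

    2k[2k²]^k≤[2k]^[2k+1] :
      (ℕ→ℚ 2 *ℚ kk G d) ^ℚ B *ℚ (ℕ→ℚ 2 *ℚ kk G d ^ℚ 2) ^ℚ a ≤ (ℕ→ℚ 2 *ℚ kk G d) ^ℚ (2 * a + B)
    2k[2k²]^k≤[2k]^[2k+1] = subst₂ _≤_ (sym 2k[2k²]^k≡) (sym ([2k]^e≡ (2 * a + B)))
      (≤⇒/ℕ-≤ ((2 * a) ^ B * P ^ a) (B ^ B * Q ^ a) ((2 * a) ^ (2 * a + B)) (B ^ (2 * a + B))
              {{B^B*Q^a≢0}} {{B^e≢0 (2 * a + B)}} (2a*[2a²]^a*B^[2a+B]≤[2a]^[2a+B]*B^B*[B²]^a a B))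

open import Defs
open import Data.Nat using (ℕ; suc; _+_; _*_)
open import Data.Integer using (+_)
open import Data.Rational using (ℚ; _/_; _≤_; _<_) renaming (_*_ to _*ℚ_)
open import Data.Fin using (Fin)
open import Data.Fin.Subset using (Subset; _∈_; ∣_∣)
open import Data.List using (List; length)
open import Data.List.Relation.Unary.All using (All)
open import Data.List.Relation.Unary.Unique.Propositional using (Unique)
open import Data.Product using (_×_; _,_)
open import Relation.Binary.PropositionalEquality using (_≡_)
open PseudoCovers

corollary1 : (G : Graph) (d : ℚ) → IsNabla1 G d → DomAssumption G d →
  (a b : ℕ) → (+ a) / suc b ≡ kk G d →
  (v : Fin (Graph.n G)) → ℓℓ G d < ℕ→ℚ ∣ N G v ∣ →
  -- |𝒯(v)| ≤ 2 (2k²)^k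
  ((L : List (List (Fin (Graph.n G)))) → Unique L → All (IsPseudoCover G d (N G v)) L →
    ℕ→ℚ (length L) ^ℚ suc b ≤ ℕ→ℚ 2 ^ℚ suc b *ℚ (ℕ→ℚ 2 *ℚ kk G d ^ℚ 2) ^ℚ a)
  -- |𝒫(v)| ≤ 2k (2k²)^k
  × ((S : Subset (Graph.n G)) → (∀ u → u ∈ S → InP G d v u) →
    ℕ→ℚ ∣ S ∣ ^ℚ suc b ≤ (ℕ→ℚ 2 *ℚ kk G d) ^ℚ suc b *ℚ (ℕ→ℚ 2 *ℚ kk G d ^ℚ 2) ^ℚ a)
  -- 2k (2k²)^k ≤ (2k)^(2k+1)
  × ((ℕ→ℚ 2 *ℚ kk G d) ^ℚ suc b *ℚ (ℕ→ℚ 2 *ℚ kk G d ^ℚ 2) ^ℚ a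
     ≤ (ℕ→ℚ 2 *ℚ kk G d) ^ℚ (2 * a + suc b))
corollary1 G d (_ , density≤d) _ a b a/B≡k v ℓ<∣Nv∣ =
    ∣𝒯∣≤2[2k²]^k G d density≤d a b a/B≡k v ℓ<∣Nv∣
  , ∣𝒫∣≤2k[2k²]^k G d density≤d a b a/B≡k v ℓ<∣Nv∣
  , 2k[2k²]^k≤[2k]^[2k+1] G d density≤d a b a/B≡k
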